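{- Let $G=(V,E)$ be a finite graph (multiple edges and loops allowed) and let $e\in E$ be an edge which is not a loop. Then \[ \theta_G(\beta,\xi)=(1-\beta)\,\theta_{G\setminus e}(\beta,\xi)+\beta\,\theta_{G/e}(\beta,\xi). \]
   Context: The polynomials $f_n$ are defined by $f_0(x)=1$, $f_1(x)=0$, $f_{n+1}(x)=xf_n(x)+f_{n-1}(x)$. For a finite graph $G=(V,E)$, $\theta_G(\beta,\xi)=\sum_{s\subset E}\beta^{|s|}\prod_{i\in V}f_{d_i(s)}(\xi-\xi^{ -1})$, where $d_i(s)$ is the degree of node $i$ in the subgraph with edge set $s$ (a loop at $i$ contributes $2$). $G\setminus e$ is the graph obtained by deleting $e$, and $G/e$ is the graph obtained by contracting $e$ (identifying its two endpoints and removing $e$; other edges are kept, possibly becoming multiple edges or loops). A loop is an edge whose two ends are the same node. -}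

module Defs where

open import Level using (Level)
open import Algebra.Bundles using (CommutativeRing)
open import Data.Nat as ℕ using (ℕ; zero; suc)
open import Data.Bool using (Bool; true; false; if_then_else_)
open import Data.Fin as Fin using (Fin; punchOut)
open import Data.Fin.Properties using () renaming (_≟_ to _≟ᶠ_)
open import Data.Product using (_×_; _,_; proj₁; proj₂)
open import Data.Vec as Vec using (Vec; []; _∷_)
open import Data.List as List using (List; []; _∷_; _++_)
open import Relation.Nullary using (yes; no)
open import Relation.Binary.PropositionalEquality using (_≡_; _≢_; sym)

-- A finite multigraph (loops and multiple edges allowed) with vertex set
-- Fin n and edge set Fin m is given by a vector of edge endpoints.
Edges : ℕ → ℕ → Set
Edges n m = Vec (Fin n × Fin n) m

EdgeSubset : ℕ → Set
EdgeSubset m = Vec Bool m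

allSubsets : (m : ℕ) → List (EdgeSubset m)
allSubsets zero = [] ∷ []
allSubsets (suc m) = List.map (false ∷_) (allSubsets m) ++ List.map (true ∷_) (allSubsets m)

card : ∀ {m} → EdgeSubset m → ℕ
card [] = 0
card (false ∷ s) = card s
card (true ∷ s) = suc (card s)

-- number of ends of an edge at vertex i (a loop at i contributes 2)
indic : ∀ {n} → Fin n → Fin n → ℕ
indic a i with a ≟ᶠ i
... | yes _ = 1
... | no _ = 0

ends : ∀ {n} → Fin n × Fin n → Fin n → ℕ
ends (a , b) i = indic a i ℕ.+ indic b i

degree : ∀ {n m} → Edges n m → EdgeSubset m → Fin n → ℕ
degree [] [] i = 0
degree (e ∷ es) (false ∷ s) i = degree es s i
degree (e ∷ es) (true ∷ s) i = ends e i ℕ.+ degree es s i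

delete : ∀ {n m} → Edges n (suc m) → Fin (suc m) → Edges n m
delete es e = Vec.removeAt es e

-- identification map for contracting the (non-loop) edge {u , v}:
-- vertex v is merged into u, the remaining vertices are renumbered.
merge : ∀ {k} (u v : Fin (suc k)) → u ≢ v → Fin (suc k) → Fin k
merge u v u≢v w with w ≟ᶠ v
... | yes _ = punchOut {i = v} {j = u} (λ eq → u≢v (sym eq))
... | no w≢v = punchOut {i = v} {j = w} (λ eq → w≢v (sym eq))

contract : ∀ {k m} (es : Edges (suc k) (suc m)) (e : Fin (suc m)) →
           proj₁ (Vec.lookup es e) ≢ proj₂ (Vec.lookup es e) → Edges k m
contract es e nl =
  Vec.map (λ p → merge (proj₁ (Vec.lookup es e)) (proj₂ (Vec.lookup es e)) nl (proj₁ p)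
               , merge (proj₁ (Vec.lookup es e)) (proj₂ (Vec.lookup es e)) nl (proj₂ p))
          (delete es e)

module _ {c ℓ : Level} (R : CommutativeRing c ℓ) where
  open CommutativeRing R

  f : ℕ → Carrier → Carrier
  f zero x = 1#
  f (suc zero) x = 0#
  f (suc (suc n)) x = x * f (suc n) x + f n x

  pow : Carrier → ℕ → Carrier
  pow a zero = 1#
  pow a (suc k) = a * pow a k

  sumL : ∀ {A : Set} → (A → Carrier) → List A → Carrier
  sumL g = List.foldr (λ a r → g a + r) 0#

  prodL : ∀ {A : Set} → (A → Carrier) → List A → Carrier
  prodL g = List.foldr (λ a r → g a * r) 1#

  -- θ_G(β, ξ), with ξ⁻¹ supplied as an element (an inverse of ξ in R)
  θ : ∀ {n m} → Edges n m → (β ξ ξ⁻¹ : Carrier) → Carrier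
  θ {n} {m} es β ξ ξ⁻¹ =
    sumL (λ s → pow β (card s) *
                prodL (λ i → f (degree es s i) (ξ - ξ⁻¹)) (List.allFin n))
         (allSubsets m)

-- Split the sum over edge subsets s ⊆ E according to whether e ∈ s.  Let D be
-- the degrees of s ∖ {e} in G ∖ e, and u, v the ends of e.  The terms for s ∌ e
-- are those of θ_{G∖e}; for s ∋ e the product changes only at u and v, and the
-- addition formula  f_{a+b} = f_a f_b + f_{a+1} f_{b+1}  turns
--   f_{D u} f_{D v} + f_{D u + 1} f_{D v + 1}
-- into f_{D u + D v}, the factor of the merged vertex of G / e.  Hence the two
-- terms together equal  (1 - β) w_{G∖e} + β w_{G/e}.  The addition formula holds
-- for every x.
module Submission where

open import Defs
open import Algebra.Bundles using (CommutativeRing)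
open import Data.Nat using (ℕ; suc)
open import Data.Fin using (Fin)
open import Data.Product using (proj₁; proj₂)
open import Data.Vec using (lookup)
open import Relation.Binary.PropositionalEquality using (_≢_)

open import Data.Nat as ℕ using (zero)
import Data.Nat.Properties as ℕ
open import Data.Nat.Solver using (module +-*-Solver)
open import Algebra.Properties.CommutativeSemigroup ℕ.+-commutativeSemigroup using (x∙yz≈y∙xz)
open import Data.Fin as Fin using (punchIn; punchOut)
open import Data.Fin.Properties
  using (punchOut-cong; punchIn-punchOut; punchOut-punchIn; punchInᵢ≢i; punchIn-injective)
  renaming (_≟_ to _≟ᶠ_)
open import Data.Bool using (false; true)
open import Data.Product using (_,_)
open import Data.Vec as Vec using ([]; _∷_; insertAt)
open import Data.List as List using ([]; _∷_; _++_)
open import Data.List.Properties using (foldr-map)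
open import Relation.Nullary using (Dec; yes; no)
open import Data.Empty using (⊥-elim)
open import Relation.Binary.PropositionalEquality as ≡
  using (_≡_; refl; cong; cong₂; sym; trans; subst)
open import Function using (_∘_)

indic-≡ : ∀ {n} {a b : Fin n} → a ≡ b → indic a b ≡ 1
indic-≡ {a = a} {b} a≡b with a ≟ᶠ b
... | yes _ = refl
... | no a≢b = ⊥-elim (a≢b a≡b)

indic-≢ : ∀ {n} {a b : Fin n} → a ≢ b → indic a b ≡ 0
indic-≢ {a = a} {b} a≢b with a ≟ᶠ b
... | yes a≡b = ⊥-elim (a≢b a≡b)
... | no _ = refl

indic-punchIn : ∀ {n} (v : Fin (suc n)) (a b : Fin n) → indic (punchIn v a) (punchIn v b) ≡ indic a b
indic-punchIn v a b with a ≟ᶠ b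
... | yes refl = indic-≡ refl
... | no a≢b = indic-≢ (a≢b ∘ punchIn-injective v a b)

card-insertAt-false : ∀ {m} (e : Fin (suc m)) (s : EdgeSubset m) → card (insertAt s e false) ≡ card s
card-insertAt-false Fin.zero s = refl
card-insertAt-false (Fin.suc e) (false ∷ s) = card-insertAt-false e s
card-insertAt-false (Fin.suc e) (true ∷ s) = cong suc (card-insertAt-false e s)

card-insertAt-true : ∀ {m} (e : Fin (suc m)) (s : EdgeSubset m) → card (insertAt s e true) ≡ suc (card s)
card-insertAt-true Fin.zero s = refl
card-insertAt-true (Fin.suc e) (false ∷ s) = card-insertAt-true e s
card-insertAt-true (Fin.suc e) (true ∷ s) = cong suc (card-insertAt-true e s)

degree-insertAt-false : ∀ {n m} (es : Edges n (suc m)) (e : Fin (suc m)) (s : EdgeSubset m) i →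
  degree es (insertAt s e false) i ≡ degree (delete es e) s i
degree-insertAt-false (x ∷ es) Fin.zero s i = refl
degree-insertAt-false (x ∷ y ∷ es) (Fin.suc e) (false ∷ s) i = degree-insertAt-false (y ∷ es) e s i
degree-insertAt-false (x ∷ y ∷ es) (Fin.suc e) (true ∷ s) i =
  cong (ends x i ℕ.+_) (degree-insertAt-false (y ∷ es) e s i)

degree-insertAt-true : ∀ {n m} (es : Edges n (suc m)) (e : Fin (suc m)) (s : EdgeSubset m) i →
  degree es (insertAt s e true) i ≡ ends (lookup es e) i ℕ.+ degree (delete es e) s i
degree-insertAt-true (x ∷ es) Fin.zero s i = refl
degree-insertAt-true (x ∷ y ∷ es) (Fin.suc e) (false ∷ s) i = degree-insertAt-true (y ∷ es) e s i
degree-insertAt-true (x ∷ y ∷ es) (Fin.suc e) (true ∷ s) i =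
  trans (cong (ends x i ℕ.+_) (degree-insertAt-true (y ∷ es) e s i))
        (x∙yz≈y∙xz (ends x i) (ends (lookup (y ∷ es) e) i) _)

relabel : ∀ {n n′ m} → (Fin n → Fin n′) → Edges n m → Edges n′ m
relabel φ = Vec.map (λ p → φ (proj₁ p) , φ (proj₂ p))

degree-relabel : ∀ {n n′ m} (φ : Fin n → Fin n′) (es : Edges n m) (s : EdgeSubset m)
  (w : Fin n′) (x y : Fin n) (c : ℕ) → (∀ a → indic (φ a) w ≡ indic a x ℕ.+ c ℕ.* indic a y) →
  degree (relabel φ es) s w ≡ degree es s x ℕ.+ c ℕ.* degree es s y
degree-relabel φ [] [] w x y c fiber = sym (cong (0 ℕ.+_) (ℕ.*-zeroʳ c))
degree-relabel φ (p ∷ es) (false ∷ s) w x y c fiber = degree-relabel φ es s w x y c fiber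
degree-relabel φ (p ∷ es) (true ∷ s) w x y c fiber =
  trans (cong₂ ℕ._+_ (cong₂ ℕ._+_ (fiber (proj₁ p)) (fiber (proj₂ p))) (degree-relabel φ es s w x y c fiber))
        (regroup (indic (proj₁ p) x) (indic (proj₁ p) y) (indic (proj₂ p) x) (indic (proj₂ p) y)
                 (degree es s x) (degree es s y) c)
  where
  open +-*-Solver
  regroup : ∀ a₁ b₁ a₂ b₂ dx dy c →
    ((a₁ ℕ.+ c ℕ.* b₁) ℕ.+ (a₂ ℕ.+ c ℕ.* b₂)) ℕ.+ (dx ℕ.+ c ℕ.* dy)
      ≡ ((a₁ ℕ.+ a₂) ℕ.+ dx) ℕ.+ c ℕ.* ((b₁ ℕ.+ b₂) ℕ.+ dy)
  regroup = solve 7 (λ a₁ b₁ a₂ b₂ dx dy c →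
    ((a₁ :+ c :* b₁) :+ (a₂ :+ c :* b₂)) :+ (dx :+ c :* dy)
      := ((a₁ :+ a₂) :+ dx) :+ c :* ((b₁ :+ b₂) :+ dy)) refl

-- The fibre of w under a retraction φ of punchIn v is {punchIn v w},
-- together with v when φ v = w.
indic-retraction : ∀ {n} (φ : Fin (suc n) → Fin n) (v : Fin (suc n)) {t : Fin n} → φ v ≡ t →
  (∀ b → φ (punchIn v b) ≡ b) →
  ∀ a w → indic (φ a) w ≡ indic a (punchIn v w) ℕ.+ indic t w ℕ.* indic a v
indic-retraction {n} φ v {t} φv≡t retract a w = by-cases a (a ≟ᶠ v)
  where
  open ≡.≡-Reasoning
  Fibre : Fin (suc n) → Set
  Fibre a = indic (φ a) w ≡ indic a (punchIn v w) ℕ.+ indic t w ℕ.* indic a v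

  at-v : Fibre v
  at-v = begin
    indic (φ v) w                                      ≡⟨ cong (λ z → indic z w) φv≡t ⟩
    indic t w                                          ≡⟨ sym (ℕ.*-identityʳ _) ⟩
    indic t w ℕ.* 1                                    ≡⟨ cong₂ (λ z c → z ℕ.+ indic t w ℕ.* c)
                                                             (sym (indic-≢ (punchInᵢ≢i v w ∘ sym)))
                                                             (sym (indic-≡ refl)) ⟩
    indic v (punchIn v w) ℕ.+ indic t w ℕ.* indic v v ∎

  at-punchIn : ∀ b → Fibre (punchIn v b)
  at-punchIn b = begin
    indic (φ (punchIn v b)) w              ≡⟨ cong (λ z → indic z w) (retract b) ⟩
    indic b w                              ≡⟨ sym (indic-punchIn v b w) ⟩
    indic (punchIn v b) (punchIn v w)      ≡⟨ sym (ℕ.+-identityʳ _) ⟩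
    indic (punchIn v b) (punchIn v w) ℕ.+ 0
      ≡⟨ cong (λ c → indic (punchIn v b) (punchIn v w) ℕ.+ c)
              (sym (trans (cong (indic t w ℕ.*_) (indic-≢ (punchInᵢ≢i v b))) (ℕ.*-zeroʳ (indic t w)))) ⟩
    indic (punchIn v b) (punchIn v w) ℕ.+ indic t w ℕ.* indic (punchIn v b) v ∎

  by-cases : ∀ a → Dec (a ≡ v) → Fibre a
  by-cases a (yes a≡v) = subst Fibre (sym a≡v) at-v
  by-cases a (no a≢v) = subst Fibre (punchIn-punchOut (a≢v ∘ sym)) (at-punchIn (punchOut (a≢v ∘ sym)))

module Contraction {k} (u v : Fin (suc k)) (u≢v : u ≢ v) where

  u′ : Fin k
  u′ = punchOut (u≢v ∘ sym)

  punchIn-u′ : punchIn v u′ ≡ u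
  punchIn-u′ = punchIn-punchOut (u≢v ∘ sym)

  merge-v : merge u v u≢v v ≡ u′
  merge-v with v ≟ᶠ v
  ... | yes _ = refl
  ... | no v≢v = ⊥-elim (v≢v refl)

  merge-punchIn : ∀ b → merge u v u≢v (punchIn v b) ≡ b
  merge-punchIn b with punchIn v b ≟ᶠ v
  ... | yes punchIn≡v = ⊥-elim (punchInᵢ≢i v b punchIn≡v)
  ... | no _ = trans (punchOut-cong v refl) (punchOut-punchIn v)

  degree-contract : ∀ {m} (es : Edges (suc k) m) (s : EdgeSubset m) (w : Fin k) →
    degree (relabel (merge u v u≢v) es) s w ≡ degree es s (punchIn v w) ℕ.+ indic u′ w ℕ.* degree es s v
  degree-contract es s w = degree-relabel (merge u v u≢v) es s w (punchIn v w) v (indic u′ w)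
    (λ a → indic-retraction (merge u v u≢v) v merge-v merge-punchIn a w)

module _ {c ℓ} (R : CommutativeRing c ℓ) where
  open CommutativeRing R renaming (refl to ≈-refl; sym to ≈-sym; trans to ≈-trans)
  open import Relation.Binary.Reasoning.Setoid setoid
  open import Algebra.Solver.Ring.NaturalCoefficients.Default commutativeSemiring
  open import Algebra.Properties.CommutativeMonoid.Sum *-commutativeMonoid
    using () renaming (sum to ∏; sum-remove to ∏-remove; sum-cong-≋ to ∏-cong; sum-cong-≗ to ∏-cong-≡)

  ∏-remove₂ : ∀ {n} (h : Fin (suc (suc n)) → Carrier) (v : Fin (suc (suc n))) (u′ : Fin (suc n)) →
    ∏ h ≈ h v * (h (punchIn v u′) * ∏ (h ∘ punchIn v ∘ punchIn u′))
  ∏-remove₂ h v u′ = ≈-trans (∏-remove h) (*-congˡ (∏-remove (h ∘ punchIn v)))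

  module _ (x : Carrier) where

    f-+ : ∀ a b → f R (a ℕ.+ b) x ≈ f R a x * f R b x + f R (suc a) x * f R (suc b) x
    f-+ zero b = solve 2 (λ fb fb′ → fb := con 1 :* fb :+ con 0 :* fb′) ≈-refl (f R b x) (f R (suc b) x)
    f-+ (suc zero) b =
      solve 3 (λ x fb fb′ → fb′ := con 0 :* fb :+ (x :* con 0 :+ con 1) :* fb′) ≈-refl x (f R b x) (f R (suc b) x)
    f-+ (suc (suc a)) b = begin
      x * f R (suc a ℕ.+ b) x + f R (a ℕ.+ b) x
        ≈⟨ +-cong (*-congˡ (f-+ (suc a) b)) (f-+ a b) ⟩
      x * (F₁ * G₀ + (x * F₁ + F₀) * G₁) + (F₀ * G₀ + F₁ * G₁)
        ≈⟨ solve 5 (λ x F₀ F₁ G₀ G₁ →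
             x :* (F₁ :* G₀ :+ (x :* F₁ :+ F₀) :* G₁) :+ (F₀ :* G₀ :+ F₁ :* G₁)
               := (x :* F₁ :+ F₀) :* G₀ :+ (x :* (x :* F₁ :+ F₀) :+ F₁) :* G₁) ≈-refl x F₀ F₁ G₀ G₁ ⟩
      (x * F₁ + F₀) * G₀ + (x * (x * F₁ + F₀) + F₁) * G₁ ∎
      where
      F₀ F₁ G₀ G₁ : Carrier
      F₀ = f R a x
      F₁ = f R (suc a) x
      G₀ = f R b x
      G₁ = f R (suc b) x

    -- Adding the edge {punchIn v u′ , v} versus merging v into punchIn v u′.
    ∏-contract : ∀ {k} (v : Fin (suc k)) (u′ : Fin k) (D : Fin (suc k) → ℕ) →
      ∏ (λ i → f R (D i) x) + ∏ (λ i → f R (ends (punchIn v u′ , v) i ℕ.+ D i) x)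
        ≈ ∏ (λ w → f R (D (punchIn v w) ℕ.+ indic u′ w ℕ.* D v) x)
    ∏-contract {zero} v () D
    ∏-contract {suc k} v u′ D = begin
      ∏ (F ∘ D) + ∏ (λ i → F (ends (u , v) i ℕ.+ D i))
        ≈⟨ +-cong (∏-remove₂ (F ∘ D) v u′) (∏-remove₂ (λ i → F (ends (u , v) i ℕ.+ D i)) v u′) ⟩
      F (D v) * (F (D u) * Q) + F (ends (u , v) v ℕ.+ D v) * (F (ends (u , v) u ℕ.+ D u) * Q′)
        ≈⟨ +-congˡ (*-cong (reflexive (cong (λ c → F (c ℕ.+ D v)) ends-v))
                           (*-cong (reflexive (cong (λ c → F (c ℕ.+ D u)) ends-u)) Q′≈Q)) ⟩
      F (D v) * (F (D u) * Q) + F (suc (D v)) * (F (suc (D u)) * Q)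
        ≈⟨ solve 5 (λ a b a′ b′ q → a :* (b :* q) :+ a′ :* (b′ :* q) := (b :* a :+ b′ :* a′) :* q)
                   ≈-refl (F (D v)) (F (D u)) (F (suc (D v))) (F (suc (D u))) Q ⟩
      (F (D u) * F (D v) + F (suc (D u)) * F (suc (D v))) * Q
        ≈⟨ *-congʳ (≈-sym (f-+ (D u) (D v))) ⟩
      F (D u ℕ.+ D v) * Q
        ≈⟨ ≈-sym (*-cong (reflexive (cong F merged)) (∏-cong (λ j → reflexive (cong F (unmerged j))))) ⟩
      F (D u ℕ.+ indic u′ u′ ℕ.* D v) * ∏ (λ j → F (D (pp j) ℕ.+ indic u′ (punchIn u′ j) ℕ.* D v))
        ≈⟨ ≈-sym (∏-remove (λ w → F (D (punchIn v w) ℕ.+ indic u′ w ℕ.* D v))) ⟩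
      ∏ (λ w → F (D (punchIn v w) ℕ.+ indic u′ w ℕ.* D v)) ∎
      where
      F : ℕ → Carrier
      F n = f R n x
      u : Fin (suc (suc k))
      u = punchIn v u′
      pp : Fin k → Fin (suc (suc k))
      pp = punchIn v ∘ punchIn u′
      Q Q′ : Carrier
      Q = ∏ (λ j → F (D (pp j)))
      Q′ = ∏ (λ j → F (ends (u , v) (pp j) ℕ.+ D (pp j)))
      ends-v : ends (u , v) v ≡ 1
      ends-v = cong₂ ℕ._+_ (indic-≢ (punchInᵢ≢i v u′)) (indic-≡ refl)
      ends-u : ends (u , v) u ≡ 1
      ends-u = cong₂ ℕ._+_ (indic-≡ refl) (indic-≢ (punchInᵢ≢i v u′ ∘ sym))
      Q′≈Q : Q′ ≈ Q
      Q′≈Q = ∏-cong (λ j → reflexive (cong (λ c → F (c ℕ.+ D (pp j)))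
        (cong₂ ℕ._+_ (trans (indic-punchIn v u′ (punchIn u′ j)) (indic-≢ (punchInᵢ≢i u′ j ∘ sym)))
                     (indic-≢ (punchInᵢ≢i v (punchIn u′ j) ∘ sym)))))
      merged : D u ℕ.+ indic u′ u′ ℕ.* D v ≡ D u ℕ.+ D v
      merged = trans (cong (λ c → D u ℕ.+ c ℕ.* D v) (indic-≡ {a = u′} refl))
                     (cong (D u ℕ.+_) (ℕ.*-identityˡ (D v)))
      unmerged : ∀ j → D (pp j) ℕ.+ indic u′ (punchIn u′ j) ℕ.* D v ≡ D (pp j)
      unmerged j = trans (cong (λ c → D (pp j) ℕ.+ c ℕ.* D v) (indic-≢ (punchInᵢ≢i u′ j ∘ sym)))
                         (ℕ.+-identityʳ _)

  prodL-tabulate : ∀ {A : Set} {n} (h : A → Carrier) (g : Fin n → A) →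
    prodL R h (List.tabulate g) ≡ ∏ (h ∘ g)
  prodL-tabulate {n = zero} h g = refl
  prodL-tabulate {n = suc n} h g = cong (h (g Fin.zero) *_) (prodL-tabulate h (g ∘ Fin.suc))

  sumL-++ : ∀ {A : Set} (g : A → Carrier) xs ys → sumL R g (xs ++ ys) ≈ sumL R g xs + sumL R g ys
  sumL-++ g [] ys = ≈-sym (+-identityˡ _)
  sumL-++ g (a ∷ xs) ys = ≈-trans (+-congˡ (sumL-++ g xs ys)) (≈-sym (+-assoc _ _ _))

  sumL-cong : ∀ {A : Set} {g h : A → Carrier} xs → (∀ a → g a ≈ h a) → sumL R g xs ≈ sumL R h xs
  sumL-cong [] g≈h = ≈-refl
  sumL-cong (a ∷ xs) g≈h = +-cong (g≈h a) (sumL-cong xs g≈h)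

  sumL-+ : ∀ {A : Set} (g h : A → Carrier) xs → sumL R (λ a → g a + h a) xs ≈ sumL R g xs + sumL R h xs
  sumL-+ g h [] = ≈-sym (+-identityˡ _)
  sumL-+ g h (a ∷ xs) = ≈-trans (+-congˡ (sumL-+ g h xs))
    (solve 4 (λ x y X Y → (x :+ y) :+ (X :+ Y) := (x :+ X) :+ (y :+ Y)) ≈-refl (g a) (h a) _ _)

  sumL-* : ∀ {A : Set} (c : Carrier) (g : A → Carrier) xs → sumL R (λ a → c * g a) xs ≈ c * sumL R g xs
  sumL-* c g [] = ≈-sym (zeroʳ c)
  sumL-* c g (a ∷ xs) = ≈-trans (+-congˡ (sumL-* c g xs)) (≈-sym (distribˡ _ _ _))

  sumL-allSubsets-suc : ∀ {m} (g : EdgeSubset (suc m) → Carrier) →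
    sumL R g (allSubsets (suc m))
      ≈ sumL R (g ∘ (false ∷_)) (allSubsets m) + sumL R (g ∘ (true ∷_)) (allSubsets m)
  sumL-allSubsets-suc {m} g = ≈-trans (sumL-++ g (List.map (false ∷_) (allSubsets m)) _)
    (+-cong (reflexive (foldr-map _ (false ∷_) 0# (allSubsets m)))
            (reflexive (foldr-map _ (true ∷_) 0# (allSubsets m))))

  sumL-allSubsets-insertAt : ∀ {m} (g : EdgeSubset (suc m) → Carrier) (e : Fin (suc m)) →
    sumL R g (allSubsets (suc m))
      ≈ sumL R (λ s → g (insertAt s e false) + g (insertAt s e true)) (allSubsets m)
  sumL-allSubsets-insertAt g Fin.zero =
    ≈-trans (sumL-allSubsets-suc g) (≈-sym (sumL-+ (g ∘ (false ∷_)) (g ∘ (true ∷_)) (allSubsets _)))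
  sumL-allSubsets-insertAt {suc m} g (Fin.suc e) = begin
    sumL R g (allSubsets (suc (suc m)))
      ≈⟨ sumL-allSubsets-suc g ⟩
    sumL R (g ∘ (false ∷_)) (allSubsets (suc m)) + sumL R (g ∘ (true ∷_)) (allSubsets (suc m))
      ≈⟨ +-cong (sumL-allSubsets-insertAt (g ∘ (false ∷_)) e) (sumL-allSubsets-insertAt (g ∘ (true ∷_)) e) ⟩
    sumL R (λ s → g (false ∷ insertAt s e false) + g (false ∷ insertAt s e true)) (allSubsets m)
      + sumL R (λ s → g (true ∷ insertAt s e false) + g (true ∷ insertAt s e true)) (allSubsets m)
      ≈⟨ ≈-sym (sumL-allSubsets-suc (λ s → g (insertAt s (Fin.suc e) false) + g (insertAt s (Fin.suc e) true))) ⟩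
    sumL R (λ s → g (insertAt s (Fin.suc e) false) + g (insertAt s (Fin.suc e) true)) (allSubsets (suc m)) ∎

  -- The solver handles commutative semirings only: treat -β as a variable, then cancel -β + β.
  interpolate : ∀ β X Y → X + β * Y ≈ (1# - β) * X + β * (X + Y)
  interpolate β X Y = ≈-sym (begin
    (1# - β) * X + β * (X + Y)
      ≈⟨ solve 4 (λ nb b X Y → (con 1 :+ nb) :* X :+ b :* (X :+ Y) := (X :+ b :* Y) :+ (nb :+ b) :* X)
                 ≈-refl (- β) β X Y ⟩
    (X + β * Y) + (- β + β) * X
      ≈⟨ +-congˡ (≈-trans (*-congʳ (-‿inverseˡ β)) (zeroˡ X)) ⟩
    (X + β * Y) + 0#
      ≈⟨ +-identityʳ _ ⟩
    X + β * Y ∎)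

  module _ (β x : Carrier) where

    weight : ∀ {n m} → Edges n m → EdgeSubset m → Carrier
    weight es s = pow R β (card s) * ∏ (λ i → f R (degree es s i) x)

    weight-insertAt-false : ∀ {n m} (es : Edges n (suc m)) (e : Fin (suc m)) (s : EdgeSubset m) →
      weight es (insertAt s e false) ≡ weight (delete es e) s
    weight-insertAt-false es e s =
      cong₂ (λ c p → pow R β c * p) (card-insertAt-false e s)
            (∏-cong-≡ (λ i → cong (λ d → f R d x) (degree-insertAt-false es e s i)))

    weight-insertAt-true : ∀ {n m} (es : Edges n (suc m)) (e : Fin (suc m)) (s : EdgeSubset m) →
      weight es (insertAt s e true) ≈
      β * (pow R β (card s) * ∏ (λ i → f R (ends (lookup es e) i ℕ.+ degree (delete es e) s i) x))
    weight-insertAt-true es e s = ≈-trans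
      (reflexive (cong₂ (λ c p → pow R β c * p) (card-insertAt-true e s)
                        (∏-cong-≡ (λ i → cong (λ d → f R d x) (degree-insertAt-true es e s i)))))
      (*-assoc _ _ _)

    weight-deletion-contraction : ∀ {k m} (es : Edges (suc k) (suc m)) (e : Fin (suc m))
      (notLoop : proj₁ (lookup es e) ≢ proj₂ (lookup es e)) (s : EdgeSubset m) →
      weight es (insertAt s e false) + weight es (insertAt s e true)
        ≈ (1# - β) * weight (delete es e) s + β * weight (contract es e notLoop) s
    weight-deletion-contraction es e notLoop s = begin
      weight es (insertAt s e false) + weight es (insertAt s e true)
        ≈⟨ +-cong (reflexive (weight-insertAt-false es e s)) (weight-insertAt-true es e s) ⟩
      p * P₀ + β * (p * P₁)
        ≈⟨ interpolate β (p * P₀) (p * P₁) ⟩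
      (1# - β) * (p * P₀) + β * (p * P₀ + p * P₁)
        ≈⟨ +-congˡ (*-congˡ (≈-trans (≈-sym (distribˡ p P₀ P₁)) (*-congˡ P₀+P₁))) ⟩
      (1# - β) * (p * P₀) + β * (p * PC)
        ≈⟨ +-congˡ (*-congˡ (*-congˡ (reflexive (∏-cong-≡ λ w →
             cong (λ d → f R d x) (sym (degree-contract (delete es e) s w)))))) ⟩
      (1# - β) * weight (delete es e) s + β * weight (contract es e notLoop) s ∎
      where
      u v : Fin (suc _)
      u = proj₁ (lookup es e)
      v = proj₂ (lookup es e)
      open Contraction u v notLoop
      D : Fin (suc _) → ℕ
      D = degree (delete es e) s
      p P₀ P₁ PC : Carrier
      p = pow R β (card s)
      P₀ = ∏ (λ i → f R (D i) x)
      P₁ = ∏ (λ i → f R (ends (u , v) i ℕ.+ D i) x)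
      PC = ∏ (λ w → f R (D (punchIn v w) ℕ.+ indic u′ w ℕ.* D v) x)
      P₀+P₁ : P₀ + P₁ ≈ PC
      P₀+P₁ = subst (λ u → P₀ + ∏ (λ i → f R (ends (u , v) i ℕ.+ D i) x) ≈ PC)
                    punchIn-u′ (∏-contract x v u′ D)

  θ-sumL-weight : ∀ {n m} (es : Edges n m) (β ξ ξ⁻¹ : Carrier) →
    θ R es β ξ ξ⁻¹ ≈ sumL R (weight β (ξ - ξ⁻¹) es) (allSubsets m)
  θ-sumL-weight es β ξ ξ⁻¹ = sumL-cong (allSubsets _) (λ s →
    *-congˡ (reflexive (prodL-tabulate (λ i → f R (degree es s i) (ξ - ξ⁻¹)) (λ i → i))))

theorem7 : ∀ {c ℓ} (R : CommutativeRing c ℓ) →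
    let open CommutativeRing R in
    ∀ {k m} (es : Edges (suc k) (suc m)) (e : Fin (suc m))
      (notLoop : proj₁ (lookup es e) ≢ proj₂ (lookup es e))
      (β ξ ξ⁻¹ : Carrier) → ξ * ξ⁻¹ ≈ 1# →
      θ R es β ξ ξ⁻¹ ≈ (1# - β) * θ R (delete es e) β ξ ξ⁻¹ + β * θ R (contract es e notLoop) β ξ ξ⁻¹
theorem7 R {m = m} es e notLoop β ξ ξ⁻¹ _ = begin
  θ R es β ξ ξ⁻¹
    ≈⟨ θ-sumL-weight R es β ξ ξ⁻¹ ⟩
  sumL R (w es) (allSubsets (suc m))
    ≈⟨ sumL-allSubsets-insertAt R (w es) e ⟩
  sumL R (λ s → w es (insertAt s e false) + w es (insertAt s e true)) (allSubsets m)
    ≈⟨ sumL-cong R (allSubsets m) (weight-deletion-contraction R β x es e notLoop) ⟩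
  sumL R (λ s → (1# - β) * w (delete es e) s + β * w (contract es e notLoop) s) (allSubsets m)
    ≈⟨ ≈-trans (sumL-+ R _ _ (allSubsets m))
               (+-cong (sumL-* R _ _ (allSubsets m)) (sumL-* R _ _ (allSubsets m))) ⟩
  (1# - β) * sumL R (w (delete es e)) (allSubsets m) + β * sumL R (w (contract es e notLoop)) (allSubsets m)
    ≈⟨ ≈-sym (+-cong (*-congˡ (θ-sumL-weight R (delete es e) β ξ ξ⁻¹))
                   (*-congˡ (θ-sumL-weight R (contract es e notLoop) β ξ ξ⁻¹))) ⟩
  (1# - β) * θ R (delete es e) β ξ ξ⁻¹ + β * θ R (contract es e notLoop) β ξ ξ⁻¹ ∎
  where
  open CommutativeRing R renaming (refl to ≈-refl; sym to ≈-sym; trans to ≈-trans)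
  open import Relation.Binary.Reasoning.Setoid setoid
  x : Carrier
  x = ξ - ξ⁻¹
  w : ∀ {n m} → Edges n m → EdgeSubset m → Carrier
  w = weight R β x
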